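{- Let $G$ be a finite simple graph on $n$ vertices with independence number $\alpha(G)=2$. If $G$ has a dominating edge $uv$ such that the graph $G\setminus\{u,v\}$ has diameter $3$, then $ecc(G)\leq n$.
   Context: The edge clique cover number $ecc(G)$ is the minimum number of cliques (vertex subsets inducing complete subgraphs) of $G$ such that both endpoints of every edge of $G$ lie together in at least one of these cliques. An edge $uv$ of $G$ is a dominating edge if every vertex of $G$ other than $u,v$ is adjacent to at least one of $u$ and $v$. $G\setminus\{u,v\}$ denotes the subgraph induced by the vertices other than $u$ and $v$. -}

module Defs where

open import Data.Nat using (ℕ; zero; suc; _≤_)
open import Data.Fin using (Fin)
open import Data.Fin.Subset using (Subset; _∈_; ∣_∣)
open import Data.List using (List; length)
open import Data.List.Membership.Propositional renaming (_∈_ to _∈ₗ_)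
open import Data.Product using (Σ; ∃; ∃-syntax; _×_; _,_)
open import Data.Sum using (_⊎_)
open import Relation.Nullary using (¬_; Dec)
open import Relation.Binary.PropositionalEquality using (_≡_; _≢_)

record Graph (n : ℕ) : Set₁ where
  field
    Adj     : Fin n → Fin n → Set
    adj?    : ∀ x y → Dec (Adj x y)
    sym     : ∀ {x y} → Adj x y → Adj y x
    irrefl  : ∀ {x} → ¬ Adj x x
open Graph public

module _ {n : ℕ} (G : Graph n) where

  IsIndependent : Subset n → Set
  IsIndependent S = ∀ x y → x ∈ S → y ∈ S → ¬ Adj G x y

  IndependenceNumber≡ : ℕ → Set
  IndependenceNumber≡ k =
    (Σ (Subset n) λ S → IsIndependent S × ∣ S ∣ ≡ k)
    × (∀ S → IsIndependent S → ∣ S ∣ ≤ k)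

  IsClique : Subset n → Set
  IsClique S = ∀ x y → x ∈ S → y ∈ S → x ≢ y → Adj G x y

  IsEdgeCliqueCover : List (Subset n) → Set
  IsEdgeCliqueCover Cs =
    (∀ C → C ∈ₗ Cs → IsClique C)
    × (∀ x y → Adj G x y → ∃[ C ] (C ∈ₗ Cs × x ∈ C × y ∈ C))

  ecc≤ : ℕ → Set
  ecc≤ k = Σ (List (Subset n)) λ Cs → IsEdgeCliqueCover Cs × length Cs ≤ k

  IsDominatingEdge : Fin n → Fin n → Set
  IsDominatingEdge u v =
    Adj G u v × (∀ w → w ≢ u → w ≢ v → Adj G w u ⊎ Adj G w v)

  data WalkAvoiding (u v : Fin n) : ℕ → Fin n → Fin n → Set where
    here : ∀ {x} → x ≢ u → x ≢ v → WalkAvoiding u v zero x x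
    step : ∀ {k x y z} → x ≢ u → x ≢ v → Adj G x y →
           WalkAvoiding u v k y z → WalkAvoiding u v (suc k) x z

  DistAvoiding≤ : Fin n → Fin n → ℕ → Fin n → Fin n → Set
  DistAvoiding≤ u v k x y = ∃[ j ] (j ≤ k × WalkAvoiding u v j x y)

  DiameterAvoiding≡ : Fin n → Fin n → ℕ → Set
  DiameterAvoiding≡ u v d =
    (∀ x y → x ≢ u → x ≢ v → y ≢ u → y ≢ v → DistAvoiding≤ u v d x y)
    × ∃[ x ] ∃[ y ] (x ≢ u × x ≢ v × y ≢ u × y ≢ v
                     × WalkAvoiding u v d x y
                     × (∀ j → WalkAvoiding u v j x y → d ≤ j))

-- Let x, y be at distance 3 in H = G ∖ {u,v}. As α(G) ≤ 2, the closed H-neighbourhoods X of x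
-- and Y of y are disjoint cliques covering H, and N(u) ∖ N(v), N(v) ∖ N(u) are cliques too.
-- Give each vertex one clique, enlarged by those of u, v adjacent to all of it: X to x, Y to y
-- and p + (N(p) ∩ Y) to every other p ∈ X, which covers the edges of H. The edges at u and v
-- then need cliques at u, v and at vertices of Y ∖ {y}: if y has a second neighbour in H, take
-- N(u) ∖ N(v), N(v) ∖ N(u) and the common neighbours of u, v in X and in Y (symmetrically for
-- x); otherwise H is a path x a b y, and ∅, {x}, {y} placed at u, v, b suffice.

module Submission where

open import Defs
open import Data.Nat using (ℕ; _≤_; _<_; _+_; s≤s)
open import Data.Nat.Properties using (≤-reflexive; ≤-trans; <-irrefl; module ≤-Reasoning)
open import Data.Bool.Properties using (T-≡)
open import Data.Fin using (Fin)
open import Data.Fin.Properties using (_≟_; all?; any?)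
open import Data.Fin.Subset using (Subset; _∈_; _∉_; ∣_∣; ⁅_⁆; _∪_)
open import Data.Fin.Subset.Properties using (x∈⁅x⁆; x∈⁅y⁆⇒x≡y; x≢y⇒x∉⁅y⁆; x∈p∪q⁺; x∈p∪q⁻; q⊆p∪q; p⊂q⇒∣p∣<∣q∣; ∣⁅x⁆∣≡1)
open import Data.Vec as Vec using ()
open import Data.Vec.Functional using (updateAt)
open import Data.Vec.Functional.Properties using (updateAt-updates; updateAt-minimal)
open import Data.Vec.Properties using (lookup∘tabulate; lookup⇒[]=; []=⇒lookup)
open import Data.List using (tabulate)
open import Data.List.Properties using (length-tabulate)
open import Data.List.Membership.Propositional using () renaming (_∈_ to _∈ₗ_)
open import Data.List.Membership.Propositional.Properties using (∈-tabulate⁺; ∈-tabulate⁻)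
open import Data.Product using (∃-syntax; _×_; _,_; proj₁; proj₂)
open import Data.Sum as Sum using (_⊎_; inj₁; inj₂; [_,_])
open import Data.Empty using (⊥; ⊥-elim)
open import Function using (_∘_; _$_; const; case_of_)
open import Function.Bundles using (Equivalence)
open import Relation.Nullary using (¬_; Dec; yes; no)
open import Relation.Nullary.Decidable using (isYes; fromWitness; toWitness; decidable-stable; _×-dec_; _⊎-dec_; _→-dec_; ¬?)
open import Relation.Unary using (Pred; Decidable)
open import Relation.Binary.PropositionalEquality as ≡ using (_≡_; _≢_; refl; cong; subst; trans; ≢-sym)

triple : ∀ {n} → Fin n → Fin n → Fin n → Subset n
triple p q r = ⁅ p ⁆ ∪ (⁅ q ⁆ ∪ ⁅ r ⁆)

∈-triple⁻ : ∀ {n} {p q r z : Fin n} → z ∈ triple p q r → z ≡ p ⊎ z ≡ q ⊎ z ≡ r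
∈-triple⁻ {p = p} {q} {r} z∈ with x∈p∪q⁻ ⁅ p ⁆ _ z∈
... | inj₁ z∈p = inj₁ (x∈⁅y⁆⇒x≡y p z∈p)
... | inj₂ z∈qr with x∈p∪q⁻ ⁅ q ⁆ ⁅ r ⁆ z∈qr
...   | inj₁ z∈q = inj₂ (inj₁ (x∈⁅y⁆⇒x≡y q z∈q))
...   | inj₂ z∈r = inj₂ (inj₂ (x∈⁅y⁆⇒x≡y r z∈r))

x∉p⇒∣p∣<∣⁅x⁆∪p∣ : ∀ {n} {x : Fin n} {p} → x ∉ p → ∣ p ∣ < ∣ ⁅ x ⁆ ∪ p ∣
x∉p⇒∣p∣<∣⁅x⁆∪p∣ {x = x} {p} x∉p = p⊂q⇒∣p∣<∣q∣ (q⊆p∪q ⁅ x ⁆ p , x , x∈p∪q⁺ (inj₁ (x∈⁅x⁆ x)) , x∉p)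

∣triple∣≥3 : ∀ {n} {p q r : Fin n} → p ≢ q → p ≢ r → q ≢ r → 3 ≤ ∣ triple p q r ∣
∣triple∣≥3 {p = p} {q} {r} p≢q p≢r q≢r = begin
  3                      ≡⟨ cong (2 +_) (≡.sym (∣⁅x⁆∣≡1 r)) ⟩
  2 + ∣ ⁅ r ⁆ ∣            ≤⟨ s≤s (x∉p⇒∣p∣<∣⁅x⁆∪p∣ (x≢y⇒x∉⁅y⁆ q≢r)) ⟩
  1 + ∣ ⁅ q ⁆ ∪ ⁅ r ⁆ ∣    ≤⟨ x∉p⇒∣p∣<∣⁅x⁆∪p∣ p∉⁅q⁆∪⁅r⁆ ⟩
  ∣ triple p q r ∣        ∎
  where
  open ≤-Reasoning
  p∉⁅q⁆∪⁅r⁆ : p ∉ ⁅ q ⁆ ∪ ⁅ r ⁆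
  p∉⁅q⁆∪⁅r⁆ = [ x≢y⇒x∉⁅y⁆ p≢q , x≢y⇒x∉⁅y⁆ p≢r ] ∘ x∈p∪q⁻ ⁅ q ⁆ ⁅ r ⁆

module _ {n : ℕ} (G : Graph n) where

  adj⇒≢ : ∀ {a b} → Adj G a b → a ≢ b
  adj⇒≢ ab refl = irrefl G ab

  triple-independent : ∀ {p q r} → ¬ Adj G p q → ¬ Adj G p r → ¬ Adj G q r →
                       IsIndependent G (triple p q r)
  triple-independent {p} {q} {r} ¬pq ¬pr ¬qr a b a∈ b∈ =
    nonadjacent (∈-triple⁻ a∈) (∈-triple⁻ b∈)
    where
    nonadjacent : ∀ {a b} → a ≡ p ⊎ a ≡ q ⊎ a ≡ r → b ≡ p ⊎ b ≡ q ⊎ b ≡ r → ¬ Adj G a b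
    nonadjacent (inj₁ refl)        (inj₁ refl)        = irrefl G
    nonadjacent (inj₁ refl)        (inj₂ (inj₁ refl)) = ¬pq
    nonadjacent (inj₁ refl)        (inj₂ (inj₂ refl)) = ¬pr
    nonadjacent (inj₂ (inj₁ refl)) (inj₁ refl)        = ¬pq ∘ sym G
    nonadjacent (inj₂ (inj₁ refl)) (inj₂ (inj₁ refl)) = irrefl G
    nonadjacent (inj₂ (inj₁ refl)) (inj₂ (inj₂ refl)) = ¬qr
    nonadjacent (inj₂ (inj₂ refl)) (inj₁ refl)        = ¬pr ∘ sym G
    nonadjacent (inj₂ (inj₂ refl)) (inj₂ (inj₁ refl)) = ¬qr ∘ sym G
    nonadjacent (inj₂ (inj₂ refl)) (inj₂ (inj₂ refl)) = irrefl G

  record DecClique : Set₁ where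
    field
      Mem      : Pred (Fin n) _
      mem?     : Decidable Mem
      adjacent : ∀ {a b} → Mem a → Mem b → a ≢ b → Adj G a b
  open DecClique public

  AdjacentToAll : Fin n → DecClique → Set
  AdjacentToAll z K = ∀ w → Mem K w → Adj G z w

  adjacentToAll? : ∀ z K → Dec (AdjacentToAll z K)
  adjacentToAll? z K = all? λ w → mem? K w →-dec adj? G z w

  singleton : Fin n → DecClique
  singleton c = record
    { Mem = _≡ c ; mem? = _≟ c ; adjacent = λ { refl refl c≢c → ⊥-elim (c≢c refl) } }

  empty : DecClique
  empty = record { Mem = λ _ → ⊥ ; mem? = λ _ → no λ () ; adjacent = λ () }

  restrict : (K : DecClique) {P : Pred (Fin n) _} → Decidable P → DecClique
  restrict K {P} P? = record
    { Mem = λ z → Mem K z × P z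
    ; mem? = λ z → mem? K z ×-dec P? z
    ; adjacent = λ a∈ b∈ → adjacent K (proj₁ a∈) (proj₁ b∈) }

  join : DecClique → DecClique → DecClique
  join K L = record
    { Mem = λ z → Mem L z ⊎ (Mem K z × AdjacentToAll z L)
    ; mem? = λ z → mem? L z ⊎-dec (mem? K z ×-dec adjacentToAll? z L)
    ; adjacent = adjacent′ }
    where
    adjacent′ : ∀ {a b} → _ → _ → a ≢ b → Adj G a b
    adjacent′ (inj₁ a∈L)        (inj₁ b∈L)        = adjacent L a∈L b∈L
    adjacent′ (inj₁ a∈L)        (inj₂ (_ , b-all)) = λ _ → sym G (b-all _ a∈L)
    adjacent′ (inj₂ (_ , a-all)) (inj₁ b∈L)        = λ _ → a-all _ b∈L
    adjacent′ (inj₂ (a∈K , _))  (inj₂ (b∈K , _))  = adjacent K a∈K b∈K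

  toSubset : DecClique → Subset n
  toSubset K = Vec.tabulate (isYes ∘ mem? K)

  ∈-toSubset⁺ : ∀ K {z} → Mem K z → z ∈ toSubset K
  ∈-toSubset⁺ K {z} z∈K = lookup⇒[]= z _ $
    trans (lookup∘tabulate _ z) (Equivalence.to T-≡ (fromWitness z∈K))

  ∈-toSubset⁻ : ∀ K {z} → z ∈ toSubset K → Mem K z
  ∈-toSubset⁻ K {z} z∈ = toWitness $
    Equivalence.from T-≡ (trans (≡.sym (lookup∘tabulate _ z)) ([]=⇒lookup z∈))

  CoveredBy : (Fin n → DecClique) → Fin n → Fin n → Set
  CoveredBy K p q = ∃[ w ] (Mem (K w) p × Mem (K w) q)

  coveredBy-sym : ∀ K {p q} → CoveredBy K p q → CoveredBy K q p
  coveredBy-sym K (w , p∈ , q∈) = w , q∈ , p∈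

  coveredAt : ∀ (K : Fin n → DecClique) w {C p q} → K w ≡ C → Mem C p → Mem C q → CoveredBy K p q
  coveredAt K w refl p∈ q∈ = w , p∈ , q∈

  vertexIndexedCover⇒ecc≤n : (K : Fin n → DecClique) → (∀ p q → Adj G p q → CoveredBy K p q) → ecc≤ G n
  vertexIndexedCover⇒ecc≤n K covers =
    cliques , (isClique , isCover) , ≤-reflexive (length-tabulate (toSubset ∘ K))
    where
    cliques = tabulate (toSubset ∘ K)
    isClique : ∀ C → C ∈ₗ cliques → IsClique G C
    isClique C C∈ with ∈-tabulate⁻ C∈
    ... | w , refl = λ a b a∈ b∈ → adjacent (K w) (∈-toSubset⁻ (K w) a∈) (∈-toSubset⁻ (K w) b∈)
    isCover : ∀ p q → Adj G p q → ∃[ C ] (C ∈ₗ cliques × p ∈ C × q ∈ C)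
    isCover p q pq with covers p q pq
    ... | w , p∈ , q∈ = toSubset (K w) , ∈-tabulate⁺ w , ∈-toSubset⁺ (K w) p∈ , ∈-toSubset⁺ (K w) q∈

module AtMostTwoIndependent {n : ℕ} (G : Graph n) (α≤2 : ∀ S → IsIndependent G S → ∣ S ∣ ≤ 2) where

  nonEdge-dominates : ∀ {a b d} → a ≢ b → ¬ Adj G a b → d ≢ a → d ≢ b → Adj G d a ⊎ Adj G d b
  nonEdge-dominates {a} {b} {d} a≢b ¬ab d≢a d≢b with adj? G d a | adj? G d b
  ... | yes da | _      = inj₁ da
  ... | no _   | yes db = inj₂ db
  ... | no ¬da | no ¬db = ⊥-elim $ <-irrefl refl $
    ≤-trans (∣triple∣≥3 a≢b (≢-sym d≢a) (≢-sym d≢b))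
            (α≤2 _ (triple-independent G ¬ab (¬da ∘ sym G) (¬db ∘ sym G)))

  nonNeighbours-adjacent : ∀ {a b d} → a ≢ b → a ≢ d → b ≢ d → ¬ Adj G d a → ¬ Adj G d b → Adj G a b
  nonNeighbours-adjacent {a} {b} a≢b a≢d b≢d ¬da ¬db with adj? G a b
  ... | yes ab = ab
  ... | no ¬ab = ⊥-elim ([ ¬da , ¬db ] (nonEdge-dominates a≢b ¬ab (≢-sym a≢d) (≢-sym b≢d)))

  exclusiveNeighbours : Fin n → Fin n → DecClique G
  exclusiveNeighbours c d = record
    { Mem = λ z → z ≢ d × Adj G c z × ¬ Adj G d z
    ; mem? = λ z → ¬? (z ≟ d) ×-dec adj? G c z ×-dec ¬? (adj? G d z)
    ; adjacent = λ (a≢d , _ , ¬da) (b≢d , _ , ¬db) a≢b → nonNeighbours-adjacent a≢b a≢d b≢d ¬da ¬db }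

_[_≔_] : ∀ {a} {A : Set a} {n} → (Fin n → A) → Fin n → A → Fin n → A
f [ i ≔ x ] = updateAt f i (const x)

module EdgeExtension {n : ℕ} (G : Graph n) (α≤2 : ∀ S → IsIndependent G S → ∣ S ∣ ≤ 2)
                     (u v : Fin n) (uv : Adj G u v) where

  open AtMostTwoIndependent G α≤2

  Avoids : Pred (Fin n) _
  Avoids z = z ≢ u × z ≢ v

  avoids? : Decidable Avoids
  avoids? z = ¬? (z ≟ u) ×-dec ¬? (z ≟ v)

  IsEnd : Pred (Fin n) _
  IsEnd z = z ≡ u ⊎ z ≡ v

  ¬IsEnd⇒Avoids : ∀ {z} → ¬ IsEnd z → Avoids z
  ¬IsEnd⇒Avoids ¬end = ¬end ∘ inj₁ , ¬end ∘ inj₂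

  end≢avoiding : ∀ {z w} → IsEnd z → Avoids w → z ≢ w
  end≢avoiding (inj₁ refl) (w≢u , _) = w≢u ∘ ≡.sym
  end≢avoiding (inj₂ refl) (_ , w≢v) = w≢v ∘ ≡.sym

  ends : DecClique G
  ends = record { Mem = IsEnd ; mem? = λ z → (z ≟ u) ⊎-dec (z ≟ v) ; adjacent = adjacent′ }
    where
    adjacent′ : ∀ {a b} → IsEnd a → IsEnd b → a ≢ b → Adj G a b
    adjacent′ (inj₁ refl) (inj₁ refl) u≢u = ⊥-elim (u≢u refl)
    adjacent′ (inj₁ refl) (inj₂ refl) _   = uv
    adjacent′ (inj₂ refl) (inj₁ refl) _   = sym G uv
    adjacent′ (inj₂ refl) (inj₂ refl) v≢v = ⊥-elim (v≢v refl)

  extend : DecClique G → DecClique G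
  extend = join G ends

  commonPart : DecClique G → DecClique G
  commonPart K = restrict G K (λ z → adj? G u z ×-dec adj? G v z)

  end-adjacentTo-commonPart : ∀ {z} K → IsEnd z → AdjacentToAll G z (commonPart K)
  end-adjacentTo-commonPart K (inj₁ refl) _ (_ , uw , _) = uw
  end-adjacentTo-commonPart K (inj₂ refl) _ (_ , _ , vw) = vw

  Joinable : (Fin n → DecClique G) → Fin n → Fin n → Set
  Joinable S z q = ∃[ w ] (Mem (S w) q × AdjacentToAll G z (S w))

  joinableAt : ∀ S w {C z q} → S w ≡ C → Mem C q → AdjacentToAll G z C → Joinable S z q
  joinableAt S w refl q∈ z-all = w , q∈ , z-all

  extend-covers : (S : Fin n → DecClique G) →
    (∃[ w ] (∀ {z} → IsEnd z → AdjacentToAll G z (S w))) →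
    (∀ {z q} → IsEnd z → Avoids q → Adj G z q → Joinable S z q) →
    (∀ {p q} → Avoids p → Avoids q → Adj G p q → CoveredBy G S p q) →
    ∀ p q → Adj G p q → CoveredBy G (extend ∘ S) p q
  extend-covers S (w , ends-all) cover-end cover-inner p q pq with mem? ends p | mem? ends q
  ... | yes p-end | yes q-end = w , inj₂ (p-end , ends-all p-end) , inj₂ (q-end , ends-all q-end)
  ... | yes p-end | no q-inner =
    let w , q∈ , p-all = cover-end p-end (¬IsEnd⇒Avoids q-inner) pq in w , inj₂ (p-end , p-all) , inj₁ q∈
  ... | no p-inner | yes q-end =
    let w , p∈ , q-all = cover-end q-end (¬IsEnd⇒Avoids p-inner) (sym G pq) in w , inj₁ p∈ , inj₂ (q-end , q-all)
  ... | no p-inner | no q-inner =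
    let w , p∈ , q∈ = cover-inner (¬IsEnd⇒Avoids p-inner) (¬IsEnd⇒Avoids q-inner) pq in w , inj₁ p∈ , inj₁ q∈

  record Far (c d : Fin n) : Set where
    field
      c-avoids          : Avoids c
      d-avoids          : Avoids d
      distinct          : c ≢ d
      nonadjacent       : ¬ Adj G c d
      noCommonNeighbour : ∀ {w} → Avoids w → Adj G c w → Adj G d w → ⊥

  far-sym : ∀ {c d} → Far c d → Far d c
  far-sym far = record
    { c-avoids = d-avoids ; d-avoids = c-avoids ; distinct = ≢-sym distinct
    ; nonadjacent = nonadjacent ∘ sym G ; noCommonNeighbour = λ w-av dw cw → noCommonNeighbour w-av cw dw }
    where open Far far

  Ball : Fin n → Pred (Fin n) _
  Ball c z = Avoids z × (z ≡ c ⊎ Adj G c z)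

  ball-far : ∀ {c d z} → Far c d → Ball c z → z ≢ d × ¬ Adj G d z
  ball-far far (_    , inj₁ refl) = distinct , nonadjacent ∘ sym G
    where open Far far
  ball-far far (z-av , inj₂ cz)   = (λ { refl → nonadjacent cz }) , noCommonNeighbour z-av cz
    where open Far far

  ball : ∀ {c d} → Far c d → DecClique G
  ball {c} far = record
    { Mem = Ball c
    ; mem? = λ z → avoids? z ×-dec ((z ≟ c) ⊎-dec adj? G c z)
    ; adjacent = λ a∈ b∈ a≢b →
        let a≢d , ¬da = ball-far far a∈ ; b≢d , ¬db = ball-far far b∈
        in nonNeighbours-adjacent a≢b a≢d b≢d ¬da ¬db }

  adjacentToAll-ball : ∀ {c d a z} (far : Far c d) → (∀ {w} → Avoids w → Adj G c w → w ≡ a) →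
                       Adj G z c → Adj G z a → AdjacentToAll G z (ball far)
  adjacentToAll-ball _ only-a zc za _ (_    , inj₁ refl) = zc
  adjacentToAll-ball _ only-a zc za _ (w-av , inj₂ cw)   = subst (Adj G _) (≡.sym (only-a w-av cw)) za

  module FarPair {x y} (far : Far x y) where
    open Far far

    X Y : DecClique G
    X = ball far
    Y = ball (far-sym far)

    ball-disjoint : ∀ {z} → Ball x z → Ball y z → ⊥
    ball-disjoint z∈X (_ , inj₁ refl) = proj₁ (ball-far far z∈X) refl
    ball-disjoint z∈X (_ , inj₂ yz)   = proj₂ (ball-far far z∈X) yz

    ball-cover : ∀ {z} → Avoids z → Ball x z ⊎ Ball y z
    ball-cover {z} z-av with z ≟ x | z ≟ y
    ... | yes z≡x | _       = inj₁ (z-av , inj₁ z≡x)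
    ... | no _    | yes z≡y = inj₂ (z-av , inj₁ z≡y)
    ... | no z≢x  | no z≢y  =
      Sum.map (λ zx → z-av , inj₂ (sym G zx)) (λ zy → z-av , inj₂ (sym G zy))
              (nonEdge-dominates distinct nonadjacent z≢x z≢y)

    crossClique : Fin n → DecClique G
    crossClique p = join G (singleton G p) (restrict G Y (adj? G p))

    ∈-crossClique : ∀ p → Mem (crossClique p) p
    ∈-crossClique p = inj₂ (refl , λ _ → proj₂)

    base : Fin n → DecClique G
    base = crossClique [ y ≔ Y ] [ x ≔ X ]

    module AgreesWithBase (S : Fin n → DecClique G)
                          (agree : ∀ {w} → Avoids w → ¬ Adj G y w → S w ≡ base w) where

      S-x : S x ≡ X
      S-x = trans (agree c-avoids (nonadjacent ∘ sym G)) (updateAt-updates x _)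

      S-y : S y ≡ Y
      S-y = trans (agree d-avoids (irrefl G))
                  (trans (updateAt-minimal y x _ (≢-sym distinct)) (updateAt-updates y _))

      S-cross : ∀ {p} → Avoids p → Adj G x p → S p ≡ crossClique p
      S-cross p-av xp = trans (agree p-av (noCommonNeighbour p-av xp))
        (trans (updateAt-minimal _ x _ (≢-sym (adj⇒≢ G xp)))
               (updateAt-minimal _ y _ λ { refl → nonadjacent xp }))

      inner-covered : ∀ {p q} → Avoids p → Avoids q → Adj G p q → CoveredBy G S p q
      inner-covered p-av q-av = byBalls (ball-cover p-av) (ball-cover q-av)
        where
        cross : ∀ {p q} → Ball x p → Ball y q → Adj G p q → CoveredBy G S p q
        cross (_    , inj₁ refl) q∈Y xq = ⊥-elim (ball-disjoint (proj₁ q∈Y , inj₂ xq) q∈Y)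
        cross (p-av , inj₂ xp)   q∈Y pq = coveredAt G S _ (S-cross p-av xp) (∈-crossClique _) (inj₁ (q∈Y , pq))

        byBalls : ∀ {p q} → Ball x p ⊎ Ball y p → Ball x q ⊎ Ball y q → Adj G p q → CoveredBy G S p q
        byBalls (inj₁ p∈X) (inj₁ q∈X) _  = coveredAt G S x S-x p∈X q∈X
        byBalls (inj₂ p∈Y) (inj₂ q∈Y) _  = coveredAt G S y S-y p∈Y q∈Y
        byBalls (inj₁ p∈X) (inj₂ q∈Y) pq = cross p∈X q∈Y pq
        byBalls (inj₂ p∈Y) (inj₁ q∈X) pq = coveredBy-sym G S (cross q∈X p∈Y (sym G pq))

    ecc≤n-twoNeighbours : ∀ {b₁ b₂} → Avoids b₁ → Avoids b₂ → Adj G y b₁ → Adj G y b₂ → b₁ ≢ b₂ → ecc≤ G n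
    ecc≤n-twoNeighbours {b₁} {b₂} (b₁≢u , b₁≢v) (b₂≢u , b₂≢v) yb₁ yb₂ b₁≢b₂ =
      vertexIndexedCover⇒ecc≤n G (extend ∘ S) $
        extend-covers S (b₁ , λ z-end → subst (AdjacentToAll G _) (≡.sym S-b₁) (end-adjacentTo-commonPart X z-end))
                      cover-end inner-covered
      where
      S : Fin n → DecClique G
      S = base [ b₂ ≔ commonPart Y ] [ b₁ ≔ commonPart X ]
               [ v ≔ exclusiveNeighbours v u ] [ u ≔ exclusiveNeighbours u v ]

      agree : ∀ {w} → Avoids w → ¬ Adj G y w → S w ≡ base w
      agree (w≢u , w≢v) ¬yw =
        trans (updateAt-minimal _ u _ w≢u) $ trans (updateAt-minimal _ v _ w≢v) $
        trans (updateAt-minimal _ b₁ _ λ { refl → ¬yw yb₁ }) (updateAt-minimal _ b₂ _ λ { refl → ¬yw yb₂ })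

      open AgreesWithBase S agree

      S-u : S u ≡ exclusiveNeighbours u v
      S-u = updateAt-updates u _

      S-v : S v ≡ exclusiveNeighbours v u
      S-v = trans (updateAt-minimal v u _ (≢-sym (adj⇒≢ G uv))) (updateAt-updates v _)

      S-b₁ : S b₁ ≡ commonPart X
      S-b₁ = trans (updateAt-minimal b₁ u _ b₁≢u) $ trans (updateAt-minimal b₁ v _ b₁≢v) (updateAt-updates b₁ _)

      S-b₂ : S b₂ ≡ commonPart Y
      S-b₂ = trans (updateAt-minimal b₂ u _ b₂≢u) $ trans (updateAt-minimal b₂ v _ b₂≢v) $
             trans (updateAt-minimal b₂ b₁ _ (≢-sym b₁≢b₂)) (updateAt-updates b₂ _)

      joinCommon : ∀ {z q} → IsEnd z → Avoids q → Adj G u q → Adj G v q → Joinable S z q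
      joinCommon z-end q-av uq vq =
        [ (λ q∈X → joinableAt S b₁ S-b₁ (q∈X , uq , vq) (end-adjacentTo-commonPart X z-end))
        , (λ q∈Y → joinableAt S b₂ S-b₂ (q∈Y , uq , vq) (end-adjacentTo-commonPart Y z-end)) ] (ball-cover q-av)

      cover-end : ∀ {z q} → IsEnd z → Avoids q → Adj G z q → Joinable S z q
      cover-end {q = q} (inj₁ refl) q-av uq with adj? G v q
      ... | no ¬vq = joinableAt S u S-u (proj₂ q-av , uq , ¬vq) (λ _ → proj₁ ∘ proj₂)
      ... | yes vq = joinCommon (inj₁ refl) q-av uq vq
      cover-end {q = q} (inj₂ refl) q-av vq with adj? G u q
      ... | no ¬uq = joinableAt S v S-v (proj₁ q-av , vq , ¬uq) (λ _ → proj₁ ∘ proj₂)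
      ... | yes uq = joinCommon (inj₂ refl) q-av uq vq

    ecc≤n-path : ∀ {a b} → Avoids a → Avoids b → Adj G x a → Adj G a b → Adj G y b →
                 (∀ {w} → Avoids w → Adj G x w → w ≡ a) → (∀ {w} → Avoids w → Adj G y w → w ≡ b) →
                 ecc≤ G n
    ecc≤n-path {a} {b} a-av b-av xa ab yb only-a only-b =
      vertexIndexedCover⇒ecc≤n G (extend ∘ S) $
        extend-covers S (u , λ _ → subst (AdjacentToAll G _) (≡.sym S-u) λ _ ()) cover-end inner-covered
      where
      S : Fin n → DecClique G
      S = base [ b ≔ singleton G y ] [ v ≔ singleton G x ] [ u ≔ empty G ]

      agree : ∀ {w} → Avoids w → ¬ Adj G y w → S w ≡ base w
      agree (w≢u , w≢v) ¬yw =
        trans (updateAt-minimal _ u _ w≢u) $ trans (updateAt-minimal _ v _ w≢v) $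
        updateAt-minimal _ b _ λ { refl → ¬yw yb }

      open AgreesWithBase S agree

      S-u : S u ≡ empty G
      S-u = updateAt-updates u _

      S-v : S v ≡ singleton G x
      S-v = trans (updateAt-minimal v u _ (≢-sym (adj⇒≢ G uv))) (updateAt-updates v _)

      S-b : S b ≡ singleton G y
      S-b = trans (updateAt-minimal b u _ (proj₁ b-av)) $ trans (updateAt-minimal b v _ (proj₂ b-av)) (updateAt-updates b _)

      a≢y×¬ya : a ≢ y × ¬ Adj G y a
      a≢y×¬ya = ball-far far (a-av , inj₂ xa)

      b≢x×¬xb : b ≢ x × ¬ Adj G x b
      b≢x×¬xb = ball-far (far-sym far) (b-av , inj₂ yb)

      adjacentToAll-crossClique : ∀ {z} → Adj G z a → Adj G z b → AdjacentToAll G z (crossClique a)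
      adjacentToAll-crossClique za zb _ (inj₂ (refl , _))               = za
      adjacentToAll-crossClique za zb _ (inj₁ ((_    , inj₁ refl) , ay)) = ⊥-elim (proj₂ a≢y×¬ya (sym G ay))
      adjacentToAll-crossClique za zb _ (inj₁ ((w-av , inj₂ yw) , _))   = subst (Adj G _) (≡.sym (only-b w-av yw)) zb

      -- A vertex of {u,v} missing x sees b, and one missing y sees a, as α(G) ≤ 2.
      cover-end : ∀ {z q} → IsEnd z → Avoids q → Adj G z q → Joinable S z q
      cover-end z-end q-av zq with ball-cover q-av
      ... | inj₁ (_ , inj₁ refl) = joinableAt S v S-v refl λ { _ refl → zq }
      ... | inj₂ (_ , inj₁ refl) = joinableAt S b S-b refl λ { _ refl → zq }
      ... | inj₁ (_ , inj₂ xq) with refl ← only-a q-av xq =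
        [ (λ zx → joinableAt S x S-x (q-av , inj₂ xq) (adjacentToAll-ball far only-a zx zq))
        , (λ zb → joinableAt S a (S-cross a-av xa) (∈-crossClique a) (adjacentToAll-crossClique zq zb)) ]
        (nonEdge-dominates (≢-sym (proj₁ b≢x×¬xb)) (proj₂ b≢x×¬xb)
                           (end≢avoiding z-end c-avoids) (end≢avoiding z-end b-av))
      ... | inj₂ (_ , inj₂ yq) with refl ← only-b q-av yq =
        [ (λ zy → joinableAt S y S-y (q-av , inj₂ yq) (adjacentToAll-ball (far-sym far) only-b zy zq))
        , (λ za → joinableAt S a (S-cross a-av xa) (inj₁ ((q-av , inj₂ yq) , ab)) (adjacentToAll-crossClique za zq)) ]
        (nonEdge-dominates (≢-sym (proj₁ a≢y×¬ya)) (proj₂ a≢y×¬ya)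
                           (end≢avoiding z-end d-avoids) (end≢avoiding z-end a-av))

  otherNeighbour-or-unique : ∀ c b → (∃[ b′ ] ((Avoids b′ × Adj G c b′) × b′ ≢ b))
                                   ⊎ (∀ {w} → Avoids w → Adj G c w → w ≡ b)
  otherNeighbour-or-unique c b with any? (λ w → (avoids? w ×-dec adj? G c w) ×-dec ¬? (w ≟ b))
  ... | yes other = inj₁ other
  ... | no ¬other = inj₂ λ {w} w-av cw → decidable-stable (w ≟ b) λ w≢b → ¬other (w , (w-av , cw) , w≢b)

  record DistanceThreePath : Set where
    field
      x a b y  : Fin n
      far      : Far x y
      a-avoids : Avoids a
      b-avoids : Avoids b
      xa       : Adj G x a
      ab       : Adj G a b
      yb       : Adj G y b

  diameter3⇒path : DiameterAvoiding≡ G u v 3 → DistanceThreePath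
  diameter3⇒path (_ , x , y , x≢u , x≢v , y≢u , y≢v ,
                  step _ _ xa (step a≢u a≢v ab (step b≢u b≢v by (here _ _))) , shortest) = record
    { x = x ; a = _ ; b = _ ; y = y ; far = far ; a-avoids = a≢u , a≢v ; b-avoids = b≢u , b≢v
    ; xa = xa ; ab = ab ; yb = sym G by }
    where
    far : Far x y
    far = record
      { c-avoids = x≢u , x≢v
      ; d-avoids = y≢u , y≢v
      ; distinct = λ { refl → case shortest 0 (here x≢u x≢v) of λ () }
      ; nonadjacent = λ xy → case shortest 1 (step x≢u x≢v xy (here y≢u y≢v)) of λ { (s≤s ()) }
      ; noCommonNeighbour = λ (w≢u , w≢v) xw yw →
          case shortest 2 (step x≢u x≢v xw (step w≢u w≢v (sym G yw) (here y≢u y≢v))) of λ { (s≤s (s≤s ())) } }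

  module _ (path : DistanceThreePath) where
    open DistanceThreePath path

    ecc≤n : ecc≤ G n
    ecc≤n with otherNeighbour-or-unique y b | otherNeighbour-or-unique x a
    ... | inj₁ (b′ , (b′-av , yb′) , b′≢b) | _ =
      FarPair.ecc≤n-twoNeighbours far b-avoids b′-av yb yb′ (≢-sym b′≢b)
    ... | inj₂ _ | inj₁ (a′ , (a′-av , xa′) , a′≢a) =
      FarPair.ecc≤n-twoNeighbours (far-sym far) a-avoids a′-av xa xa′ (≢-sym a′≢a)
    ... | inj₂ only-b | inj₂ only-a = FarPair.ecc≤n-path far a-avoids b-avoids xa ab yb only-a only-b

theorem4 : (n : ℕ) (G : Graph n) → IndependenceNumber≡ G 2 → (u v : Fin n) → IsDominatingEdge G u v → DiameterAvoiding≡ G u v 3 → ecc≤ G n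
theorem4 n G (_ , α≤2) u v (uv , _) diameter = ecc≤n (diameter3⇒path diameter)
  where open EdgeExtension G α≤2 u v uv
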